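{- Let $\mathscr Q_n$ be a non-singular quadric in $\mathrm{PG}(n,2)$ of projective index $g\ge1$, let $0\le s<g$, and let $\alpha_s$ be an $s$-dimensional subspace contained in $\mathscr Q_n$. Then every generator of $\mathscr Q_n$ contains at least one point of type (ii) with respect to $\alpha_s$.
   Context: The projective index $g$ of a non-singular quadric is the largest dimension of a subspace contained in it; a generator is a $g$-dimensional subspace contained in $\mathscr Q_n$. A point of $\mathscr Q_n$ is of type (ii) with respect to $\alpha_s$ if it is not in $\alpha_s$ but lies in some $(s+1)$-dimensional subspace $\Pi$ with $\alpha_s\subset\Pi\subseteq\mathscr Q_n$. -}

module Defs where

open import Data.Nat using (ℕ; zero; suc)
open import Data.Bool using (Bool; true; false; _xor_; _∧_)
open import Data.Fin using (Fin)
open import Data.Product using (Σ; ∃; _×_)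
open import Relation.Nullary using (¬_)
open import Relation.Binary.PropositionalEquality using (_≡_)

-- GF(2) is modelled by Bool: addition = xor, multiplication = ∧.

⊕ : ∀ {k} → (Fin k → Bool) → Bool
⊕ {zero}  f = false
⊕ {suc k} f = f Fin.zero xor ⊕ (λ i → f (Fin.suc i))

-- Vectors of GF(2)^(n+1); nonzero ones represent points of PG(n,2).
Vect : ℕ → Set
Vect n = Fin (suc n) → Bool

_≈_ : ∀ {n} → Vect n → Vect n → Set
x ≈ y = ∀ i → x i ≡ y i

0v : ∀ {n} → Vect n
0v i = false

_+v_ : ∀ {n} → Vect n → Vect n → Vect n
(x +v y) i = x i xor y i

NonZero : ∀ {n} → Vect n → Set
NonZero x = ¬ (x ≈ 0v)

comb : ∀ {n k} → (Fin k → Vect n) → (Fin k → Bool) → Vect n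
comb B c j = ⊕ (λ i → c i ∧ B i j)

Independent : ∀ {n k} → (Fin k → Vect n) → Set
Independent B = ∀ c → comb B c ≈ 0v → ∀ i → c i ≡ false

InSpan : ∀ {n k} → (Fin k → Vect n) → Vect n → Set
InSpan B x = Σ _ λ c → comb B c ≈ x

-- A projective subspace of dimension d of PG(n,2) is given by a basis of
-- d+1 independent vectors (the subspace is its span).
Basis : ℕ → ℕ → Set
Basis n d = Fin (suc d) → Vect n

QForm : ℕ → Set
QForm n = Fin (suc n) → Fin (suc n) → Bool

evalQ : ∀ {n} → QForm n → Vect n → Bool
evalQ a x = ⊕ (λ i → ⊕ (λ j → a i j ∧ (x i ∧ x j)))

polar : ∀ {n} → QForm n → Vect n → Vect n → Bool
polar a x y = evalQ a (x +v y) xor (evalQ a x xor evalQ a y)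

OnQuadric : ∀ {n} → QForm n → Vect n → Set
OnQuadric a x = NonZero x × evalQ a x ≡ false

NonSingular : ∀ {n} → QForm n → Set
NonSingular a = ¬ (Σ _ λ x → OnQuadric a x × (∀ y → polar a x y ≡ false))

Contained : ∀ {n k} → QForm n → (Fin k → Vect n) → Set
Contained a B = ∀ c → evalQ a (comb B c) ≡ false

IsSubspaceOnQ : ∀ {n} → QForm n → (d : ℕ) → Basis n d → Set
IsSubspaceOnQ a d B = Independent B × Contained a B

open import Data.Nat using (_≤_)
ProjIndex : ∀ {n} → QForm n → ℕ → Set
ProjIndex {n} a g =
  (Σ (Basis n g) λ G → IsSubspaceOnQ a g G) ×
  (∀ d (B : Basis n d) → IsSubspaceOnQ a d B → d ≤ g)

IsGenerator : ∀ {n} → QForm n → (g : ℕ) → Basis n g → Set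
IsGenerator a g G = IsSubspaceOnQ a g G

TypeII : ∀ {n} → QForm n → (s : ℕ) → Basis n s → Vect n → Set
TypeII {n} a s A x =
  OnQuadric a x × ¬ InSpan A x ×
  Σ (Basis n (suc s)) λ P →
    IsSubspaceOnQ a (suc s) P ×
    (∀ y → InSpan A y → InSpan P y) ×
    InSpan P x

-- Let W be the span of α_s and Γ that of the generator, of vector dimensions s + 1 < g + 1, and B the
-- polar form. It suffices to find x ∈ Γ with B(x, W) = 0 and x ∉ W: then Q(x + w) = Q(x) + Q(w) + B(x, w) = 0,
-- so ⟨α_s, x⟩ is an (s+1)-space on the quadric through α_s, and x is of type (ii).
-- If B(γ, w) = 1 for basis vectors γ ∈ Γ and w ∈ W, one step of Gaussian elimination on each side replaces
-- Γ by Γ ∩ w^⊥ and W by W ∩ γ^⊥, lowering both dimensions by one. A solution x of the smaller problem solves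
-- the original one: x ⟂ W = ⟨w⟩ + (W ∩ γ^⊥), and x ∈ W would give x ∈ W ∩ γ^⊥ because B(γ, x) = 0 on the
-- totally singular Γ. Once B(Γ, W) = 0, some basis vector of Γ lies outside W by the Steinitz exchange
-- lemma, as dim Γ > dim W.

module Submission where

open import Defs
open import Algebra.Bundles using (CommutativeRing)
open import Data.Bool using (Bool; true; false; _xor_; _∧_; _≟_)
open import Data.Bool.Properties
  using (xor-comm; xor-same; xor-identityʳ; ∧-identityʳ; ∧-zeroʳ; ∧-assoc;
         ∧-distribˡ-xor; ∧-distribʳ-xor; ¬-not; xor-∧-commutativeRing)
open import Data.Empty using (⊥-elim)
open import Data.Fin using (Fin; zero; suc; punchIn; punchOut) renaming (_≟_ to _≟ᶠ_)
open import Data.Fin.Properties using (any?; all?; punchIn-punchOut)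
open import Data.Fin.Subset.Properties using (anySubset?)
open import Data.Nat using (ℕ; zero; suc; _≤_; _<_; z≤n; s≤s)
open import Data.Nat.Properties using (m≤n⇒m≤1+n; <⇒≱)
open import Data.Product using (Σ; _×_; _,_; proj₁; proj₂)
open import Data.Vec using (lookup; tabulate)
open import Data.Vec.Properties using (lookup∘tabulate)
open import Data.Vec.Functional using (_∷_; insertAt; removeAt)
open import Data.Vec.Functional.Properties using (insertAt-lookup; insertAt-punchIn; insertAt-removeAt)
open import Function using (_∘_)
open import Relation.Binary.PropositionalEquality
open import Relation.Nullary using (¬_; Dec; yes; no; ¬?)
open import Relation.Nullary.Decidable using (map′; decidable-stable)

open CommutativeRing xor-∧-commutativeRing using (semiring; +-group; +-commutativeSemigroup)
open import Algebra.Properties.Semiring.Sum semiring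
  using (sum; sum-cong-≗; ∑-distrib-+; *-distribˡ-sum; *-distribʳ-sum; sum-remove; sum-replicate-zero)
open import Algebra.Properties.CommutativeSemigroup +-commutativeSemigroup using (interchange)
open import Algebra.Properties.Group +-group
  using () renaming (//-rightDividesʳ to xor-cancelʳ; x∙y⁻¹≈ε⇒x≈y to xor≡false⇒≡)

private
  variable
    n k p : ℕ

⊕≡sum : (f : Fin k → Bool) → ⊕ f ≡ sum f
⊕≡sum {zero}  f = refl
⊕≡sum {suc k} f = cong (f zero xor_) (⊕≡sum (f ∘ suc))

⊕-cong : {f g : Fin k → Bool} → (∀ i → f i ≡ g i) → ⊕ f ≡ ⊕ g
⊕-cong {f = f} {g} f≗g = trans (⊕≡sum f) (trans (sum-cong-≗ f≗g) (sym (⊕≡sum g)))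

⊕-zero : ⊕ {k} (λ _ → false) ≡ false
⊕-zero {k} = trans (⊕≡sum {k} (λ _ → false)) (sum-replicate-zero k)

⊕-xor : (f g : Fin k → Bool) → ⊕ (λ i → f i xor g i) ≡ ⊕ f xor ⊕ g
⊕-xor f g = begin
  ⊕ (λ i → f i xor g i)  ≡⟨ ⊕≡sum (λ i → f i xor g i) ⟩
  sum (λ i → f i xor g i) ≡⟨ ∑-distrib-+ f g ⟩
  sum f xor sum g        ≡⟨ cong₂ _xor_ (⊕≡sum f) (⊕≡sum g) ⟨
  ⊕ f xor ⊕ g            ∎
  where open ≡-Reasoning

⊕-∧ˡ : (t : Bool) (f : Fin k → Bool) → ⊕ (λ i → t ∧ f i) ≡ t ∧ ⊕ f
⊕-∧ˡ t f = trans (⊕≡sum (λ i → t ∧ f i)) (trans (sym (*-distribˡ-sum t f)) (cong (t ∧_) (sym (⊕≡sum f))))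

⊕-∧ʳ : (t : Bool) (f : Fin k → Bool) → ⊕ (λ i → f i ∧ t) ≡ ⊕ f ∧ t
⊕-∧ʳ t f = trans (⊕≡sum (λ i → f i ∧ t)) (trans (sym (*-distribʳ-sum t f)) (cong (_∧ t) (sym (⊕≡sum f))))

⊕-remove : (f : Fin (suc k) → Bool) (i : Fin (suc k)) → ⊕ f ≡ f i xor ⊕ (f ∘ punchIn i)
⊕-remove f i = trans (⊕≡sum f) (trans (sum-remove f) (cong (f i xor_) (sym (⊕≡sum (removeAt f i)))))

xor-∧-true : ∀ t → t xor (t ∧ true) ≡ false
xor-∧-true t = trans (cong (t xor_) (∧-identityʳ t)) (xor-same t)

≈-sym : {x y : Vect n} → x ≈ y → y ≈ x
≈-sym x≈y j = sym (x≈y j)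

≈-trans : {x y z : Vect n} → x ≈ y → y ≈ z → x ≈ z
≈-trans x≈y y≈z j = trans (x≈y j) (y≈z j)

_*v_ : Bool → Vect n → Vect n
(t *v v) j = t ∧ v j

module _ (B : Fin k → Vect n) where

  comb-cong : {c d : Fin k → Bool} → (∀ i → c i ≡ d i) → comb B c ≈ comb B d
  comb-cong c≗d j = ⊕-cong (λ i → cong (_∧ B i j) (c≗d i))

  comb-zero : comb B (λ _ → false) ≈ 0v
  comb-zero j = ⊕-zero {k}

  comb-xor : (c d : Fin k → Bool) → comb B (λ i → c i xor d i) ≈ (comb B c +v comb B d)
  comb-xor c d j = trans (⊕-cong λ i → ∧-distribʳ-xor (B i j) (c i) (d i))
                         (⊕-xor (λ i → c i ∧ B i j) (λ i → d i ∧ B i j))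

  comb-∧ : (t : Bool) (c : Fin k → Bool) → comb B (λ i → t ∧ c i) ≈ (t *v comb B c)
  comb-∧ t c j = trans (⊕-cong λ i → ∧-assoc t (c i) (B i j)) (⊕-∧ˡ t (λ i → c i ∧ B i j))

  span-+v : {x y : Vect n} → InSpan B x → InSpan B y → InSpan B (x +v y)
  span-+v (c , c≈x) (d , d≈y) =
    (λ i → c i xor d i) , λ j → trans (comb-xor c d j) (cong₂ _xor_ (c≈x j) (d≈y j))

  ∉span⇒nonzero : {x : Vect n} → ¬ InSpan B x → NonZero x
  ∉span⇒nonzero x∉B x≈0 = x∉B ((λ _ → false) , ≈-trans comb-zero (≈-sym x≈0))

span? : (B : Fin k → Vect n) (x : Vect n) → Dec (InSpan B x)
span? B x = map′ (λ (s , s≈x) → lookup s , s≈x)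
                 (λ (c , c≈x) → tabulate c , ≈-trans (comb-cong B (lookup∘tabulate c)) c≈x)
                 (anySubset? λ s → all? λ j → comb B (lookup s) j ≟ x j)

comb-tail : (B : Fin (suc k) → Vect n) (c : Fin (suc k) → Bool) →
            c zero ≡ false → comb B c ≈ comb (B ∘ suc) (c ∘ suc)
comb-tail B c c₀≡false j = cong (λ t → (t ∧ B zero j) xor comb (B ∘ suc) (c ∘ suc) j) c₀≡false

comb-insertAt : (B : Fin (suc k) → Vect n) (i : Fin (suc k)) (c : Fin k → Bool) (t : Bool) →
                comb B (insertAt c i t) ≈ ((t *v B i) +v comb (B ∘ punchIn i) c)
comb-insertAt B i c t j =
  trans (⊕-remove (λ m → insertAt c i t m ∧ B m j) i)
        (cong₂ _xor_ (cong (_∧ B i j) (insertAt-lookup c i t))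
                     (⊕-cong λ l → cong (_∧ B (punchIn i l) j) (insertAt-punchIn c i t l)))

unit : Fin (suc k) → Fin (suc k) → Bool
unit i = insertAt (λ _ → false) i true

comb-unit : (B : Fin (suc k) → Vect n) (i : Fin (suc k)) → comb B (unit i) ≈ B i
comb-unit B i j =
  trans (comb-insertAt B i _ true j)
        (trans (cong (B i j xor_) (comb-zero (B ∘ punchIn i) j)) (xor-identityʳ (B i j)))

span-self : (B : Fin (suc k) → Vect n) (i : Fin (suc k)) → InSpan B (B i)
span-self B i = unit i , comb-unit B i

independent⇒nonzero : {B : Fin (suc k) → Vect n} → Independent B → ∀ i → NonZero (B i)
independent⇒nonzero {B = B} indB i Bi≈0 with trans (sym (insertAt-lookup _ i true))
                                                    (indB (unit i) (≈-trans (comb-unit B i) Bi≈0) i)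
... | ()

independent-∷ : {A : Fin k → Vect n} {x : Vect n} → Independent A → ¬ InSpan A x → Independent (x ∷ A)
independent-∷ {A = A} {x} indA x∉A c xA≈0 = λ where
    zero    → c₀≡false
    (suc i) → indA (c ∘ suc) (≈-trans (≈-sym (comb-tail (x ∷ A) c c₀≡false)) xA≈0) i
  where
  head-false : ∀ t d → comb (x ∷ A) (t ∷ d) ≈ 0v → t ≡ false
  head-false false d _       = refl
  head-false true  d x+Ad≈0 = ⊥-elim (x∉A (d , λ j → sym (xor≡false⇒≡ (x j) (comb A d j) (x+Ad≈0 j))))
  c₀≡false : c zero ≡ false
  c₀≡false = head-false (c zero) (c ∘ suc) xA≈0

pivot : (Fin (suc k) → Vect n) → Fin (suc k) → (Fin k → Bool) → Fin k → Vect n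
pivot B i ε l = B (punchIn i l) +v (ε l *v B i)

comb-pivot : (B : Fin (suc k) → Vect n) (i : Fin (suc k)) (ε c : Fin k → Bool) →
             comb (pivot B i ε) c ≈ comb B (insertAt c i (⊕ λ l → c l ∧ ε l))
comb-pivot B i ε c j = begin
  ⊕ (λ l → c l ∧ (B (punchIn i l) j xor (ε l ∧ B i j)))
    ≡⟨ ⊕-cong (λ l → ∧-distribˡ-xor (c l) _ _) ⟩
  ⊕ (λ l → (c l ∧ B (punchIn i l) j) xor (c l ∧ (ε l ∧ B i j)))
    ≡⟨ ⊕-xor (λ l → c l ∧ B (punchIn i l) j) (λ l → c l ∧ (ε l ∧ B i j)) ⟩
  comb (B ∘ punchIn i) c j xor ⊕ (λ l → c l ∧ (ε l ∧ B i j))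
    ≡⟨ cong (comb (B ∘ punchIn i) c j xor_)
            (trans (⊕-cong λ l → sym (∧-assoc (c l) (ε l) (B i j))) (⊕-∧ʳ (B i j) (λ l → c l ∧ ε l))) ⟩
  comb (B ∘ punchIn i) c j xor (t ∧ B i j)
    ≡⟨ xor-comm (comb (B ∘ punchIn i) c j) (t ∧ B i j) ⟩
  (t ∧ B i j) xor comb (B ∘ punchIn i) c j
    ≡⟨ comb-insertAt B i c t j ⟨
  comb B (insertAt c i t) j ∎
  where
  open ≡-Reasoning
  t = ⊕ λ l → c l ∧ ε l

module _ (B : Fin (suc k) → Vect n) (i : Fin (suc k)) (ε : Fin k → Bool) where

  pivot-span⊆ : {x : Vect n} → InSpan (pivot B i ε) x → InSpan B x
  pivot-span⊆ (c , c≈x) = insertAt c i (⊕ λ l → c l ∧ ε l) , ≈-trans (≈-sym (comb-pivot B i ε c)) c≈x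

  pivot-independent : Independent B → Independent (pivot B i ε)
  pivot-independent indB c c≈0 l =
    trans (sym (insertAt-punchIn c i t l))
          (indB (insertAt c i t) (≈-trans (≈-sym (comb-pivot B i ε c)) c≈0) (punchIn i l))
    where t = ⊕ λ l → c l ∧ ε l

  unpivot : ∀ l → B (punchIn i l) ≈ (pivot B i ε l +v (ε l *v B i))
  unpivot l j = sym (xor-cancelʳ (ε l ∧ B i j) (B (punchIn i l) j))

independent-in-span⇒≤ : (G : Fin p → Vect n) (A : Fin k → Vect n) (D : Fin p → Fin k → Bool) →
                        Independent G → (∀ j → comb A (D j) ≈ G j) → p ≤ k
independent-in-span⇒≤ {p = zero}              G A D indG AD≈G = z≤n
independent-in-span⇒≤ {p = suc p} {k = zero}  G A D indG AD≈G =
  ⊥-elim (independent⇒nonzero {B = G} indG zero (≈-sym (AD≈G zero)))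
independent-in-span⇒≤ {p = suc p} {k = suc k} G A D indG AD≈G with any? (λ j → D j zero ≟ true)
... | no ∄j = m≤n⇒m≤1+n (independent-in-span⇒≤ G (A ∘ suc) (λ j → D j ∘ suc) indG
                 λ j → ≈-trans (≈-sym (comb-tail A (D j) (¬-not λ Dj₀ → ∄j (j , Dj₀)))) (AD≈G j))
... | yes (j , Dj₀) = s≤s (independent-in-span⇒≤ (pivot G j ε) (A ∘ suc) (λ l → D′ l ∘ suc)
                        (pivot-independent G j ε indG)
                        λ l → ≈-trans (≈-sym (comb-tail A (D′ l) (D′-head l))) (AD′≈pivot l))
  where
  ε : Fin p → Bool
  ε l = D (punchIn j l) zero
  D′ : Fin p → Fin (suc k) → Bool
  D′ l m = D (punchIn j l) m xor (ε l ∧ D j m)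
  D′-head : ∀ l → D′ l zero ≡ false
  D′-head l = trans (cong (λ t → ε l xor (ε l ∧ t)) Dj₀) (xor-∧-true (ε l))
  AD′≈pivot : ∀ l → comb A (D′ l) ≈ pivot G j ε l
  AD′≈pivot l x = trans (comb-xor A (D (punchIn j l)) (λ m → ε l ∧ D j m) x)
                        (cong₂ _xor_ (AD≈G (punchIn j l) x)
                                     (trans (comb-∧ A (ε l) (D j) x) (cong (ε l ∧_) (AD≈G j x))))

record IsLinear (φ : Vect n → Bool) : Set where
  field
    resp-≈   : {x y : Vect n} → x ≈ y → φ x ≡ φ y
    additive : (x y : Vect n) → φ (x +v y) ≡ φ x xor φ y

open IsLinear

const-false-linear : IsLinear {n} (λ _ → false)
const-false-linear = record { resp-≈ = λ _ → refl ; additive = λ _ _ → refl }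

xor-linear : {φ ψ : Vect n → Bool} → IsLinear φ → IsLinear ψ → IsLinear (λ x → φ x xor ψ x)
xor-linear {φ = φ} {ψ} φ-lin ψ-lin = record
  { resp-≈   = λ x≈y → cong₂ _xor_ (resp-≈ φ-lin x≈y) (resp-≈ ψ-lin x≈y)
  ; additive = λ x y → trans (cong₂ _xor_ (additive φ-lin x y) (additive ψ-lin x y))
                             (interchange (φ x) (φ y) (ψ x) (ψ y))
  }

⊕-linear : {φ : Fin k → Vect n → Bool} → (∀ i → IsLinear (φ i)) → IsLinear (λ x → ⊕ λ i → φ i x)
⊕-linear {zero}  φ-lin = const-false-linear
⊕-linear {suc k} φ-lin = xor-linear (φ-lin zero) (⊕-linear (φ-lin ∘ suc))

module _ {φ : Vect n → Bool} (φ-lin : IsLinear φ) where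

  linear-0v : φ 0v ≡ false
  linear-0v = trans (additive φ-lin 0v 0v) (xor-same (φ 0v))

  linear-*v : (t : Bool) (v : Vect n) → φ (t *v v) ≡ t ∧ φ v
  linear-*v false v = linear-0v
  linear-*v true  v = refl

  linear-comb : (B : Fin k → Vect n) (c : Fin k → Bool) → φ (comb B c) ≡ ⊕ (λ i → c i ∧ φ (B i))
  linear-comb {zero}  B c = linear-0v
  linear-comb {suc k} B c =
    trans (additive φ-lin (c zero *v B zero) (comb (B ∘ suc) (c ∘ suc)))
          (cong₂ _xor_ (linear-*v (c zero) (B zero)) (linear-comb (B ∘ suc) (c ∘ suc)))

  linear-vanish : {B : Fin k → Vect n} {x : Vect n} →
                  (∀ i → φ (B i) ≡ false) → InSpan B x → φ x ≡ false
  linear-vanish {k = k} {B = B} φB≡0 (c , c≈x) =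
    trans (resp-≈ φ-lin (≈-sym c≈x))
      (trans (linear-comb B c)
        (trans (⊕-cong λ i → trans (cong (c i ∧_) (φB≡0 i)) (∧-zeroʳ (c i))) (⊕-zero {k})))

  pivot-vanish : (B : Fin (suc k) → Vect n) (i : Fin (suc k)) (ε : Fin k → Bool) →
                 φ (B i) ≡ false → (∀ l → φ (pivot B i ε l) ≡ false) → ∀ m → φ (B m) ≡ false
  pivot-vanish B i ε φBi≡0 φpivot≡0 m with i ≟ᶠ m
  ... | yes refl = φBi≡0
  pivot-vanish B i ε φBi≡0 φpivot≡0 m | no i≢m = begin
    φ (B m)                                ≡⟨ cong (φ ∘ B) (punchIn-punchOut i≢m) ⟨
    φ (B (punchIn i l))                    ≡⟨ resp-≈ φ-lin (unpivot B i ε l) ⟩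
    φ (pivot B i ε l +v (ε l *v B i))      ≡⟨ additive φ-lin _ _ ⟩
    φ (pivot B i ε l) xor φ (ε l *v B i)   ≡⟨ cong₂ _xor_ (φpivot≡0 l) (linear-*v (ε l) (B i)) ⟩
    ε l ∧ φ (B i)                          ≡⟨ cong (ε l ∧_) φBi≡0 ⟩
    ε l ∧ false                            ≡⟨ ∧-zeroʳ (ε l) ⟩
    false                                  ∎
    where
    open ≡-Reasoning
    l = punchOut i≢m

  eliminate : (Fin (suc k) → Vect n) → Fin (suc k) → Fin k → Vect n
  eliminate B i = pivot B i (φ ∘ B ∘ punchIn i)

  eliminate-kernel : (B : Fin (suc k) → Vect n) (i : Fin (suc k)) →
                     φ (B i) ≡ true → ∀ l → φ (eliminate B i l) ≡ false
  eliminate-kernel B i φBi≡1 l =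
    trans (additive φ-lin _ _)
          (trans (cong (e xor_) (trans (linear-*v e (B i)) (cong (e ∧_) φBi≡1))) (xor-∧-true e))
    where e = φ (B (punchIn i l))

  kernel⊆eliminate-span : (B : Fin (suc k) → Vect n) (i : Fin (suc k)) {x : Vect n} →
                          φ (B i) ≡ true → InSpan B x → φ x ≡ false → InSpan (eliminate B i) x
  kernel⊆eliminate-span B i {x} φBi≡1 (d , d≈x) φx≡0 =
    removeAt d i ,
    ≈-trans (comb-pivot B i (φ ∘ B ∘ punchIn i) (removeAt d i))
      (≈-trans (comb-cong B λ m → trans (cong (λ t → insertAt (removeAt d i) i t m) (sym di≡t))
                                       (insertAt-removeAt d i m))
               d≈x)
    where
    t = ⊕ (λ l → d (punchIn i l) ∧ φ (B (punchIn i l)))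
    di≡t : d i ≡ t
    di≡t = xor≡false⇒≡ (d i) t (begin
      d i xor t
        ≡⟨ cong (_xor t) (trans (cong (d i ∧_) φBi≡1) (∧-identityʳ (d i))) ⟨
      (d i ∧ φ (B i)) xor t
        ≡⟨ ⊕-remove (λ m → d m ∧ φ (B m)) i ⟨
      ⊕ (λ m → d m ∧ φ (B m))
        ≡⟨ linear-comb B d ⟨
      φ (comb B d)
        ≡⟨ resp-≈ φ-lin d≈x ⟩
      φ x
        ≡⟨ φx≡0 ⟩
      false ∎)
      where open ≡-Reasoning

module _ (a : QForm n) where

  form : Vect n → Vect n → Bool
  form x y = ⊕ λ i → ⊕ λ j → a i j ∧ (x i ∧ y j)

  -- evalQ a x is form x x by definition, and bil is the polar form of evalQ a (see evalQ-+v).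
  bil : Vect n → Vect n → Bool
  bil x y = form x y xor form y x

  form-linearˡ : ∀ y → IsLinear (λ x → form x y)
  form-linearˡ y = ⊕-linear λ i → ⊕-linear λ j → record
    { resp-≈   = λ x≈x′ → cong (λ t → a i j ∧ (t ∧ y j)) (x≈x′ i)
    ; additive = λ x x′ → trans (cong (a i j ∧_) (∧-distribʳ-xor (y j) (x i) (x′ i)))
                                (∧-distribˡ-xor (a i j) (x i ∧ y j) (x′ i ∧ y j))
    }

  form-linearʳ : ∀ x → IsLinear (form x)
  form-linearʳ x = ⊕-linear λ i → ⊕-linear λ j → record
    { resp-≈   = λ y≈y′ → cong (λ t → a i j ∧ (x i ∧ t)) (y≈y′ j)
    ; additive = λ y y′ → trans (cong (a i j ∧_) (∧-distribˡ-xor (x i) (y j) (y′ j)))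
                                (∧-distribˡ-xor (a i j) (x i ∧ y j) (x i ∧ y′ j))
    }

  bil-linearˡ : ∀ y → IsLinear (λ x → bil x y)
  bil-linearˡ y = xor-linear (form-linearˡ y) (form-linearʳ y)

  bil-linearʳ : ∀ x → IsLinear (bil x)
  bil-linearʳ x = xor-linear (form-linearʳ x) (form-linearˡ x)

  evalQ-cong : {x y : Vect n} → x ≈ y → evalQ a x ≡ evalQ a y
  evalQ-cong {x} {y} x≈y = trans (resp-≈ (form-linearˡ x) x≈y) (resp-≈ (form-linearʳ y) x≈y)

  evalQ-+v : ∀ x y → evalQ a (x +v y) ≡ (evalQ a x xor evalQ a y) xor bil x y
  evalQ-+v x y = begin
    form (x +v y) (x +v y)
      ≡⟨ additive (form-linearˡ (x +v y)) x y ⟩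
    form x (x +v y) xor form y (x +v y)
      ≡⟨ cong₂ _xor_ (additive (form-linearʳ x) x y) (additive (form-linearʳ y) x y) ⟩
    (form x x xor form x y) xor (form y x xor form y y)
      ≡⟨ cong ((form x x xor form x y) xor_) (xor-comm (form y x) (form y y)) ⟩
    (form x x xor form x y) xor (form y y xor form y x)
      ≡⟨ interchange (form x x) (form x y) (form y y) (form y x) ⟩
    (form x x xor form y y) xor (form x y xor form y x) ∎
    where open ≡-Reasoning

  TotallySingular : (Fin k → Vect n) → Set
  TotallySingular B = ∀ {x y} → InSpan B x → InSpan B y → bil x y ≡ false

  contained⇒evalQ-span : {B : Fin k → Vect n} {x : Vect n} → Contained a B → InSpan B x → evalQ a x ≡ false
  contained⇒evalQ-span B⊆Q (c , c≈x) = trans (evalQ-cong (≈-sym c≈x)) (B⊆Q c)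

  contained⇒totallySingular : {B : Fin k → Vect n} → Contained a B → TotallySingular B
  contained⇒totallySingular {B = B} B⊆Q {x} {y} x∈B y∈B = begin
    bil x y
      ≡⟨ cong₂ (λ u v → (u xor v) xor bil x y) (Q≡0 x∈B) (Q≡0 y∈B) ⟨
    (evalQ a x xor evalQ a y) xor bil x y
      ≡⟨ evalQ-+v x y ⟨
    evalQ a (x +v y)
      ≡⟨ Q≡0 (span-+v B x∈B y∈B) ⟩
    false ∎
    where
    open ≡-Reasoning
    Q≡0 : ∀ {z} → InSpan B z → evalQ a z ≡ false
    Q≡0 = contained⇒evalQ-span B⊆Q

  _⟂_ : Vect n → (Fin k → Vect n) → Set
  x ⟂ A = ∀ i → bil x (A i) ≡ false

  contained-∷ : {A : Fin k → Vect n} {x : Vect n} →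
                Contained a A → evalQ a x ≡ false → x ⟂ A → Contained a (x ∷ A)
  contained-∷ {A = A} {x} A⊆Q Qx≡0 x⟂A c = go (c zero) (c ∘ suc)
    where
    go : ∀ t d → evalQ a (comb (x ∷ A) (t ∷ d)) ≡ false
    go false d = A⊆Q d
    go true  d = trans (evalQ-+v x (comb A d))
                       (cong₂ _xor_ (cong₂ _xor_ Qx≡0 (A⊆Q d))
                                    (linear-vanish (bil-linearʳ x) {B = A} x⟂A (d , λ _ → refl)))

  typeII-of-escape : {s : ℕ} (A : Basis n s) (x : Vect n) → IsSubspaceOnQ a s A →
                     evalQ a x ≡ false → x ⟂ A → ¬ InSpan A x → TypeII a s A x
  typeII-of-escape A x (indA , A⊆Q) Qx≡0 x⟂A x∉A =
    (∉span⇒nonzero A x∉A , Qx≡0) , x∉A ,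
    (x ∷ A) , (independent-∷ {A = A} indA x∉A , contained-∷ {A = A} {x} A⊆Q Qx≡0 x⟂A) ,
    (λ _ (c , c≈y) → (false ∷ c) , c≈y) , span-self (x ∷ A) zero

  Escape : (Fin p → Vect n) → (Fin k → Vect n) → Set
  Escape G A = Σ (Vect n) λ x → InSpan G x × x ⟂ A × ¬ InSpan A x

  escape-of-⟂ : (G : Fin p → Vect n) (A : Fin k → Vect n) →
                k < p → Independent G → (∀ j → G j ⟂ A) → Escape G A
  escape-of-⟂ {p = suc p} G A k<p indG G⟂A with any? (λ j → ¬? (span? A (G j)))
  ... | yes (j , Gj∉A) = G j , span-self G j , G⟂A j , Gj∉A
  ... | no ∄j = ⊥-elim (<⇒≱ k<p (independent-in-span⇒≤ G A (proj₁ ∘ G∈A) indG (proj₂ ∘ G∈A)))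
    where
    G∈A : ∀ j → InSpan A (G j)
    G∈A j = decidable-stable (span? A (G j)) λ Gj∉A → ∄j (j , Gj∉A)

  escape-pivot : (G : Fin (suc p) → Vect n) (A : Fin (suc k) → Vect n) (j : Fin (suc p)) (i : Fin (suc k)) →
                 TotallySingular G → bil (G j) (A i) ≡ true →
                 Escape (eliminate (bil-linearˡ (A i)) G j) (eliminate (bil-linearʳ (G j)) A i) → Escape G A
  escape-pivot G A j i G-sing GjAi≡1 (x , x∈G′ , x⟂A′ , x∉A′) = x , x∈G , x⟂A , x∉A
    where
    x∈G : InSpan G x
    x∈G = pivot-span⊆ G j (λ l → bil (G (punchIn j l)) (A i)) x∈G′
    x⟂Ai : bil x (A i) ≡ false
    x⟂Ai = linear-vanish (bil-linearˡ (A i)) (eliminate-kernel (bil-linearˡ (A i)) G j GjAi≡1) x∈G′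
    x⟂A : x ⟂ A
    x⟂A = pivot-vanish (bil-linearʳ x) A i (bil (G j) ∘ A ∘ punchIn i) x⟂Ai x⟂A′
    x∉A : ¬ InSpan A x
    x∉A x∈A = x∉A′ (kernel⊆eliminate-span (bil-linearʳ (G j)) A i GjAi≡1 x∈A (G-sing (span-self G j) x∈G))

  orthogonal-escape : k < p → (G : Fin p → Vect n) (A : Fin k → Vect n) →
                      Independent G → TotallySingular G → Escape G A
  orthogonal-escape {zero}          k<p G A indG G-sing = escape-of-⟂ G A k<p indG λ _ ()
  orthogonal-escape {suc k} {suc p} (s≤s k<p) G A indG G-sing
    with any? (λ i → any? λ j → bil (G j) (A i) ≟ true)
  ... | no ∄ij = escape-of-⟂ G A (s≤s k<p) indG λ j i → ¬-not λ GjAi≡1 → ∄ij (i , j , GjAi≡1)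
  ... | yes (i , j , GjAi≡1) =
    escape-pivot G A j i G-sing GjAi≡1
      (orthogonal-escape k<p (eliminate (bil-linearˡ (A i)) G j) (eliminate (bil-linearʳ (G j)) A i)
        (pivot-independent G j ε indG) λ x∈G′ y∈G′ → G-sing (pivot-span⊆ G j ε x∈G′) (pivot-span⊆ G j ε y∈G′))
    where
    ε : Fin p → Bool
    ε l = bil (G (punchIn j l)) (A i)

lemma5p3 : (n : ℕ) (a : QForm n) (g s : ℕ) →
    NonSingular a → ProjIndex a g → 1 ≤ g → s < g →
    (A : Basis n s) → IsSubspaceOnQ a s A →
    (G : Basis n g) → IsGenerator a g G →
    Σ (Vect n) λ x → InSpan G x × TypeII a s A x
lemma5p3 n a g s _ _ _ s<g A α G (indG , G⊆Q) =
  finish (orthogonal-escape a (s≤s s<g) G A indG (contained⇒totallySingular a {B = G} G⊆Q))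
  where
  finish : Escape a G A → Σ (Vect n) λ x → InSpan G x × TypeII a s A x
  finish (x , x∈G , x⟂A , x∉A) =
    x , x∈G , typeII-of-escape a A x α (contained⇒evalQ-span a {B = G} G⊆Q x∈G) x⟂A x∉A
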